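{- Let $\mathbf B\in\mathcal V$ (an idempotent algebra), let $C\le\mathbf B$ be a subuniverse, $b\in B$, and let $P$ be a $\mathbf B$-pendant such that $C\subseteq P|_0$ and $b\in P|_1$. Then $C[b]|_1\subseteq P|_1$.
   Context: Fix a positive integer $m$. Let $\mathcal V$ be the variety whose basic operations are a $2m$-ary symbol $f$ and $m$-ary symbols $g_1,g_2$, axiomatized exactly by idempotence of $f,g_1,g_2$ ($t(x,\dots,x)=x$) and the identities $f(x,\dots,x,y,x,\dots,x)=g_1(x,\dots,x,y,x,\dots,x)$ ($y$ in position $i$ on both sides, $i=1,\dots,m$) and $f(x,\dots,x,y,x,\dots,x)=g_2(x,\dots,x,y,x,\dots,x)$ ($y$ in position $m+i$ on the left and $i$ on the right, $i=1,\dots,m$). Let $\mathbf A$ be the $\mathcal V$-free algebra generated by two elements $0,1$. For $n\in\{1,2,\dots\}\cup\{\omega\}$, $R_n\le\mathbf A^n$ is the subuniverse generated by all $n$-tuples having $1$ in exactly one coordinate and $0$ in all others. For $\mathbf B\in\mathcal V$, a $\mathbf B$-pendant is a subuniverse $P\le\mathbf B\times\mathbf A^\omega$ invariant under all permutations of the $\omega$ coordinates of $\mathbf A^\omega$. Set $P|_0=\{b\in B:(b,(0,0,\dots))\in P\}$ and $P|_1=\{b\in B:\exists \bar r\in R_\omega,\ (b,\bar r)\in P\}$. For a subuniverse $C\le\mathbf B$ and $b\in B$, $C[b]$ denotes the smallest $\mathbf B$-pendant $P$ with $C\subseteq P|_0$ and $\{b\}\times R_\omega\subseteq P$. -}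

module Defs where

open import Data.Nat using (ℕ; _+_)
open import Data.Fin using (Fin; _↑ˡ_; _↑ʳ_) renaming (_≟_ to _≟F_)
open import Data.Bool using (if_then_else_)
open import Relation.Nullary.Decidable using (⌊_⌋)
open import Data.Product using (Σ; _×_; ∃)
open import Function using (_∘_)
open import Function.Bundles using (_↔_; Inverse)
open import Relation.Binary.PropositionalEquality using (_≡_)

updF : {n : ℕ} {A : Set} → A → A → Fin n → Fin n → A
updF x y i j = if ⌊ j ≟F i ⌋ then y else x

module _ (m : ℕ) where

  record VAlgebra : Set₁ where
    field
      Carrier : Set
      f  : (Fin (m + m) → Carrier) → Carrier
      g₁ : (Fin m → Carrier) → Carrier
      g₂ : (Fin m → Carrier) → Carrier
      f-idem  : ∀ x → f (λ _ → x) ≡ x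
      g₁-idem : ∀ x → g₁ (λ _ → x) ≡ x
      g₂-idem : ∀ x → g₂ (λ _ → x) ≡ x
      fg₁ : ∀ x y (i : Fin m) → f (updF x y (i ↑ˡ m)) ≡ g₁ (updF x y i)
      fg₂ : ∀ x y (i : Fin m) → f (updF x y (m ↑ʳ i)) ≡ g₂ (updF x y i)

  -- The free algebra A on generators 0,1: terms modulo the fully
  -- invariant congruence generated by the axioms of V (a setoid).
  data Term : Set where
    𝟎 𝟏 : Term
    f  : (Fin (m + m) → Term) → Term
    g₁ : (Fin m → Term) → Term
    g₂ : (Fin m → Term) → Term

  infix 4 _≈_
  data _≈_ : Term → Term → Set where
    refl≈  : ∀ {t} → t ≈ t
    sym≈   : ∀ {s t} → s ≈ t → t ≈ s
    trans≈ : ∀ {s t u} → s ≈ t → t ≈ u → s ≈ u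
    cong-f  : ∀ {ss ts} → (∀ j → ss j ≈ ts j) → f ss ≈ f ts
    cong-g₁ : ∀ {ss ts} → (∀ j → ss j ≈ ts j) → g₁ ss ≈ g₁ ts
    cong-g₂ : ∀ {ss ts} → (∀ j → ss j ≈ ts j) → g₂ ss ≈ g₂ ts
    f-idem  : ∀ x → f (λ _ → x) ≈ x
    g₁-idem : ∀ x → g₁ (λ _ → x) ≈ x
    g₂-idem : ∀ x → g₂ (λ _ → x) ≈ x
    fg₁ : ∀ x y (i : Fin m) → f (updF x y (i ↑ˡ m)) ≈ g₁ (updF x y i)
    fg₂ : ∀ x y (i : Fin m) → f (updF x y (m ↑ʳ i)) ≈ g₂ (updF x y i)

  -- elements of A^ω are represented by sequences of terms,
  -- equal when pointwise ≈.
  Seq : Set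
  Seq = ℕ → Term

  _≈ω_ : Seq → Seq → Set
  r ≈ω r' = ∀ k → r k ≈ r' k

  zeroSeq : Seq
  zeroSeq _ = 𝟎

  unitSeq : ℕ → Seq
  unitSeq i k = if ⌊ k Data.Nat.≟ i ⌋ then 𝟏 else 𝟎

  data Rω : Seq → Set where
    Runit : ∀ i → Rω (unitSeq i)
    Rresp : ∀ {r r'} → Rω r → r ≈ω r' → Rω r'
    Rclo-f  : (rs : Fin (m + m) → Seq) → (∀ j → Rω (rs j)) → Rω (λ k → f (λ j → rs j k))
    Rclo-g₁ : (rs : Fin m → Seq) → (∀ j → Rω (rs j)) → Rω (λ k → g₁ (λ j → rs j k))
    Rclo-g₂ : (rs : Fin m → Seq) → (∀ j → Rω (rs j)) → Rω (λ k → g₂ (λ j → rs j k))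

  module _ (B : VAlgebra) where
    open VAlgebra B renaming (f to fB; g₁ to g₁B; g₂ to g₂B)

    record Subuniverse : Set₁ where
      field
        mem : Carrier → Set
        sclo-f  : (bs : Fin (m + m) → Carrier) → (∀ j → mem (bs j)) → mem (fB bs)
        sclo-g₁ : (bs : Fin m → Carrier) → (∀ j → mem (bs j)) → mem (g₁B bs)
        sclo-g₂ : (bs : Fin m → Carrier) → (∀ j → mem (bs j)) → mem (g₂B bs)

    record Pendant : Set₁ where
      field
        mem : Carrier → Seq → Set
        presp : ∀ {b r r'} → mem b r → r ≈ω r' → mem b r'
        pclo-f  : (bs : Fin (m + m) → Carrier) (rs : Fin (m + m) → Seq) →
                 (∀ j → mem (bs j) (rs j)) → mem (fB bs) (λ k → f (λ j → rs j k))
        pclo-g₁ : (bs : Fin m → Carrier) (rs : Fin m → Seq) →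
                 (∀ j → mem (bs j) (rs j)) → mem (g₁B bs) (λ k → g₁ (λ j → rs j k))
        pclo-g₂ : (bs : Fin m → Carrier) (rs : Fin m → Seq) →
                 (∀ j → mem (bs j) (rs j)) → mem (g₂B bs) (λ k → g₂ (λ j → rs j k))
        pperm : (π : ℕ ↔ ℕ) → ∀ {b r} → mem b r → mem b (r ∘ Inverse.to π)

    _∣₀ : Pendant → Carrier → Set
    (P ∣₀) b = Pendant.mem P b zeroSeq

    _∣₁ : Pendant → Carrier → Set
    (P ∣₁) b = ∃ λ r → Rω r × Pendant.mem P b r

    -- C[b] : the smallest pendant P with C ⊆ P|₀ and {b} × R_ω ⊆ P,
    -- given as the intersection of all such pendants
    gen-mem : Subuniverse → Carrier → Carrier → Seq → Set₁
    gen-mem C b x r =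
      (Q : Pendant) →
      (∀ c → Subuniverse.mem C c → (Q ∣₀) c) →
      (∀ r' → Rω r' → Pendant.mem Q b r') →
      Pendant.mem Q x r

    gen∣₁ : Subuniverse → Carrier → Carrier → Set₁
    gen∣₁ C b x = ∃ λ r → Rω r × gen-mem C b x r

-- Let ρ ∈ R_ω witness b ∈ P|₁; like every element of R_ω it vanishes from some
-- N on. Cut ω into blocks of length N and let inflate : A^ω → A^ω put into block q the
-- image of ρ under the endomorphism of A fixing 0 and sending 1 to r_q. Then inflate is a
-- homomorphism sending the unit tuple e_l to a permutation of ρ (block 0 moved to
-- block l), so by idempotence inflate maps R_ω into R_ω and {b} × R_ω into P. Hence
-- {(x, r) : (x, inflate(r ∘ π)) ∈ P for all permutations π} is a pendant containing
-- C × {0} and {b} × R_ω, so it contains C[b], and (x, r) ∈ C[b] with r ∈ R_ω gives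
-- (x, inflate r) ∈ P with inflate r ∈ R_ω.
module Submission where

open import Defs
open import Data.Nat as ℕ using (ℕ; zero; suc; _+_; _*_; _≤_; _⊔_; _/_; _%_; NonZero)
open import Data.Nat.Properties using (≤-trans; m≤m⊔n; m≤n⇒m≤o⊔n; m≤m+n; m≤n+m; n≤1+n; <-irrefl; +-identityʳ)
open import Data.Nat.DivMod using (m≡m%n+[m/n]*n; [m+kn]%n≡m%n; m%n<n; m<n⇒m%n≡m; m<n⇒m/n≡0; +-distrib-/-∣ʳ; m*n/n≡m)
open import Data.Nat.Divisibility using (n∣m*n)
open import Data.Fin using (Fin)
open import Data.Product using (∃; _,_; proj₁; proj₂)
open import Data.Empty using (⊥-elim)
open import Function using (_∘_)
open import Function.Bundles using (_↔_; Inverse; mk↔ₛ′)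
open import Function.Construct.Composition using (_↔-∘_)
open import Function.Construct.Identity using (↔-id)
open import Relation.Binary.Definitions using (DecidableEquality)
open import Relation.Nullary using (Dec; yes; no)
open import Relation.Binary.PropositionalEquality
  using (_≡_; _≢_; refl; sym; trans; cong; cong₂; subst; module ≡-Reasoning)

updF-natural : ∀ {A B : Set} {n} (h : A → B) x y (i j : Fin n) →
               h (updF x y i j) ≡ updF (h x) (h y) i j
updF-natural h x y i j with j Data.Fin.≟ i
... | yes _ = refl
... | no _  = refl

upperBound : ∀ {n} (M : Fin n → ℕ) → ∃ λ K → ∀ j → M j ≤ K
upperBound {zero}  M = 0 , λ ()
upperBound {suc n} M with upperBound (M ∘ Fin.suc)
... | K , M≤K = M Fin.zero ⊔ K , λ where
  Fin.zero    → m≤m⊔n _ _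
  (Fin.suc j) → m≤n⇒m≤o⊔n (M Fin.zero) (M≤K j)

module _ {a} {A : Set a} (_≟_ : DecidableEquality A) where

  transpose : A → A → A → A
  transpose i j k with k ≟ i | k ≟ j
  ... | yes _ | _     = j
  ... | no _  | yes _ = i
  ... | no _  | no _  = k

  transpose-ˡ : ∀ i j → transpose i j i ≡ j
  transpose-ˡ i j with i ≟ i
  ... | yes _   = refl
  ... | no i≢i = ⊥-elim (i≢i refl)

  transpose-ʳ : ∀ i j → transpose i j j ≡ i
  transpose-ʳ i j with j ≟ i | j ≟ j
  ... | yes j≡i | _       = j≡i
  ... | no _    | yes _   = refl
  ... | no _    | no j≢j = ⊥-elim (j≢j refl)

  transpose-involutive : ∀ i j k → transpose i j (transpose i j k) ≡ k
  transpose-involutive i j k with k ≟ i | k ≟ j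
  ... | yes refl | _        = transpose-ʳ k j
  ... | no _     | yes refl = transpose-ˡ i k
  ... | no k≢i   | no k≢j   with k ≟ i | k ≟ j
  ...   | yes k≡i | _       = ⊥-elim (k≢i k≡i)
  ...   | no _    | yes k≡j = ⊥-elim (k≢j k≡j)
  ...   | no _    | no _    = refl

module Blocks (N : ℕ) .{{_ : NonZero N}} where

  relocate : (ℕ → ℕ) → ℕ → ℕ
  relocate t k = k % N + t (k / N) * N

  /-relocate : ∀ t k → relocate t k / N ≡ t (k / N)
  /-relocate t k = begin
    (k % N + t (k / N) * N) / N       ≡⟨ +-distrib-/-∣ʳ (k % N) (n∣m*n (t (k / N))) ⟩
    k % N / N + t (k / N) * N / N     ≡⟨ cong₂ _+_ (m<n⇒m/n≡0 (m%n<n k N)) (m*n/n≡m (t (k / N)) N) ⟩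
    t (k / N)                         ∎
    where open ≡-Reasoning

  %-relocate : ∀ t k → relocate t k % N ≡ k % N
  %-relocate t k = trans ([m+kn]%n≡m%n (k % N) (t (k / N)) N) (m<n⇒m%n≡m (m%n<n k N))

  relocate-involutive : ∀ t → (∀ q → t (t q) ≡ q) → ∀ k → relocate t (relocate t k) ≡ k
  relocate-involutive t t-inv k = begin
    relocate t k % N + t (relocate t k / N) * N ≡⟨ cong₂ (λ a q → a + t q * N) (%-relocate t k) (/-relocate t k) ⟩
    k % N + t (t (k / N)) * N                   ≡⟨ cong (λ q → k % N + q * N) (t-inv (k / N)) ⟩
    k % N + k / N * N                           ≡⟨ sym (m≡m%n+[m/n]*n k N) ⟩
    k                                           ∎
    where open ≡-Reasoning

  relocate↔ : ∀ t → (∀ q → t (t q) ≡ q) → ℕ ↔ ℕ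
  relocate↔ t t-inv = mk↔ₛ′ (relocate t) (relocate t) (relocate-involutive t t-inv) (relocate-involutive t t-inv)

  relocate-first : ∀ t k → t (k / N) ≡ 0 → relocate t k ≡ k % N
  relocate-first t k t≡0 = trans (cong (λ q → k % N + q * N) t≡0) (+-identityʳ (k % N))

  relocate-later : ∀ t k → t (k / N) ≢ 0 → N ≤ relocate t k
  relocate-later t k t≢0 with t (k / N)
  ... | zero  = ⊥-elim (t≢0 refl)
  ... | suc q = ≤-trans (m≤m+n N (q * N)) (m≤n+m (N + q * N) (k % N))

module _ {m : ℕ} where

  ≈-reflexive : ∀ {s t : Term m} → s ≡ t → _≈_ m s t
  ≈-reflexive refl = refl≈

  ≈ω-sym : ∀ {r r' : Seq m} → _≈ω_ m r r' → _≈ω_ m r' r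
  ≈ω-sym r≈r' k = sym≈ (r≈r' k)

  infix 8 _[𝟏≔_]

  _[𝟏≔_] : Term m → Term m → Term m
  𝟎 [𝟏≔ a ]      = 𝟎
  𝟏 [𝟏≔ a ]      = a
  f ts [𝟏≔ a ]   = f (λ j → ts j [𝟏≔ a ])
  g₁ ts [𝟏≔ a ]  = g₁ (λ j → ts j [𝟏≔ a ])
  g₂ ts [𝟏≔ a ]  = g₂ (λ j → ts j [𝟏≔ a ])

  [𝟏≔]-cong : ∀ a {s t} → _≈_ m s t → _≈_ m (s [𝟏≔ a ]) (t [𝟏≔ a ])
  [𝟏≔]-cong a refl≈         = refl≈
  [𝟏≔]-cong a (sym≈ p)      = sym≈ ([𝟏≔]-cong a p)
  [𝟏≔]-cong a (trans≈ p q)  = trans≈ ([𝟏≔]-cong a p) ([𝟏≔]-cong a q)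
  [𝟏≔]-cong a (cong-f p)    = cong-f (λ j → [𝟏≔]-cong a (p j))
  [𝟏≔]-cong a (cong-g₁ p)   = cong-g₁ (λ j → [𝟏≔]-cong a (p j))
  [𝟏≔]-cong a (cong-g₂ p)   = cong-g₂ (λ j → [𝟏≔]-cong a (p j))
  [𝟏≔]-cong a (f-idem x)    = f-idem (x [𝟏≔ a ])
  [𝟏≔]-cong a (g₁-idem x)   = g₁-idem (x [𝟏≔ a ])
  [𝟏≔]-cong a (g₂-idem x)   = g₂-idem (x [𝟏≔ a ])
  [𝟏≔]-cong a (fg₁ x y i)   =
    trans≈ (cong-f (λ j → ≈-reflexive (updF-natural (_[𝟏≔ a ]) x y _ j)))
      (trans≈ (fg₁ (x [𝟏≔ a ]) (y [𝟏≔ a ]) i)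
        (cong-g₁ (λ j → ≈-reflexive (sym (updF-natural (_[𝟏≔ a ]) x y i j)))))
  [𝟏≔]-cong a (fg₂ x y i)   =
    trans≈ (cong-f (λ j → ≈-reflexive (updF-natural (_[𝟏≔ a ]) x y _ j)))
      (trans≈ (fg₂ (x [𝟏≔ a ]) (y [𝟏≔ a ]) i)
        (cong-g₂ (λ j → ≈-reflexive (sym (updF-natural (_[𝟏≔ a ]) x y i j)))))

  unitSeq-self : ∀ i → unitSeq m i i ≡ 𝟏
  unitSeq-self i with i ℕ.≟ i
  ... | yes _   = refl
  ... | no i≢i = ⊥-elim (i≢i refl)

  unitSeq-≢ : ∀ {i k} → k ≢ i → unitSeq m i k ≡ 𝟎
  unitSeq-≢ {i} {k} k≢i with k ℕ.≟ i
  ... | yes k≡i = ⊥-elim (k≢i k≡i)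
  ... | no _    = refl

  record IsSubuniverseω (S : Seq m → Set) : Set where
    field
      resp      : ∀ {r r'} → S r → _≈ω_ m r r' → S r'
      closed-f  : (rs : Fin (m + m) → Seq m) → (∀ j → S (rs j)) → S (λ k → f (λ j → rs j k))
      closed-g₁ : (rs : Fin m → Seq m) → (∀ j → S (rs j)) → S (λ k → g₁ (λ j → rs j k))
      closed-g₂ : (rs : Fin m → Seq m) → (∀ j → S (rs j)) → S (λ k → g₂ (λ j → rs j k))

  open IsSubuniverseω

  Rω-isSubuniverseω : IsSubuniverseω (Rω m)
  Rω-isSubuniverseω = record
    { resp = Rresp ; closed-f = Rclo-f ; closed-g₁ = Rclo-g₁ ; closed-g₂ = Rclo-g₂ }

  Rω-least : ∀ {S} → IsSubuniverseω S → (∀ i → S (unitSeq m i)) → ∀ {r} → Rω m r → S r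
  Rω-least S-sub units (Runit i)         = units i
  Rω-least S-sub units (Rresp r∈R r≈r')  = resp S-sub (Rω-least S-sub units r∈R) r≈r'
  Rω-least S-sub units (Rclo-f rs rs∈R)  = closed-f S-sub rs (λ j → Rω-least S-sub units (rs∈R j))
  Rω-least S-sub units (Rclo-g₁ rs rs∈R) = closed-g₁ S-sub rs (λ j → Rω-least S-sub units (rs∈R j))
  Rω-least S-sub units (Rclo-g₂ rs rs∈R) = closed-g₂ S-sub rs (λ j → Rω-least S-sub units (rs∈R j))

  IsSubuniverseω-∘ : ∀ {S} → IsSubuniverseω S → (g : ℕ → ℕ) → IsSubuniverseω (λ r → S (r ∘ g))
  IsSubuniverseω-∘ S-sub g = record
    { resp      = λ s r≈r' → resp S-sub s (r≈r' ∘ g)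
    ; closed-f  = λ rs → closed-f S-sub (λ j → rs j ∘ g)
    ; closed-g₁ = λ rs → closed-g₁ S-sub (λ j → rs j ∘ g)
    ; closed-g₂ = λ rs → closed-g₂ S-sub (λ j → rs j ∘ g)
    }

  unitSeq-∘↔ : (π : ℕ ↔ ℕ) → ∀ i k → unitSeq m (Inverse.from π i) k ≡ unitSeq m i (Inverse.to π k)
  unitSeq-∘↔ π i k with k ℕ.≟ Inverse.from π i
  ... | yes refl = sym (trans (cong (unitSeq m i) (Inverse.strictlyInverseˡ π i)) (unitSeq-self i))
  ... | no k≢    = sym (unitSeq-≢ λ e → k≢ (trans (sym (Inverse.strictlyInverseʳ π k)) (cong (Inverse.from π) e)))

  Rω-∘↔ : ∀ {r} → Rω m r → (π : ℕ ↔ ℕ) → Rω m (r ∘ Inverse.to π)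
  Rω-∘↔ r∈R π = Rω-least (IsSubuniverseω-∘ Rω-isSubuniverseω (Inverse.to π))
    (λ i → Rresp (Runit (Inverse.from π i)) (≈-reflexive ∘ unitSeq-∘↔ π i)) r∈R

  VanishesFrom : ℕ → Seq m → Set
  VanishesFrom M r = ∀ k → M ≤ k → _≈_ m (r k) 𝟎

  FinitelySupported : Seq m → Set
  FinitelySupported r = ∃ λ M → VanishesFrom M r

  VanishesFrom-mono : ∀ {M M' r} → M ≤ M' → VanishesFrom M r → VanishesFrom M' r
  VanishesFrom-mono M≤M' r-vanishes k M'≤k = r-vanishes k (≤-trans M≤M' M'≤k)

  commonVanishing : ∀ {n} {rs : Fin n → Seq m} → (∀ j → FinitelySupported (rs j)) →
                    ∃ λ K → ∀ j → VanishesFrom K (rs j)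
  commonVanishing supp with upperBound (proj₁ ∘ supp)
  ... | K , M≤K = K , λ j → VanishesFrom-mono (M≤K j) (proj₂ (supp j))

  finitelySupported-isSubuniverseω : IsSubuniverseω FinitelySupported
  finitelySupported-isSubuniverseω = record
    { resp      = λ (M , r-vanishes) r≈r' → M , λ k M≤k → trans≈ (sym≈ (r≈r' k)) (r-vanishes k M≤k)
    ; closed-f  = λ rs supp → let K , v = commonVanishing supp in
                  K , λ k K≤k → trans≈ (cong-f (λ j → v j k K≤k)) (f-idem 𝟎)
    ; closed-g₁ = λ rs supp → let K , v = commonVanishing supp in
                  K , λ k K≤k → trans≈ (cong-g₁ (λ j → v j k K≤k)) (g₁-idem 𝟎)
    ; closed-g₂ = λ rs supp → let K , v = commonVanishing supp in
                  K , λ k K≤k → trans≈ (cong-g₂ (λ j → v j k K≤k)) (g₂-idem 𝟎)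
    }

  Rω-finitelySupported : ∀ {r} → Rω m r → FinitelySupported r
  Rω-finitelySupported = Rω-least finitelySupported-isSubuniverseω
    (λ i → suc i , λ k i<k → ≈-reflexive (unitSeq-≢ λ { refl → <-irrefl refl i<k }))

  fibre-isSubuniverseω : (B : VAlgebra m) (P : Pendant m B) (b : VAlgebra.Carrier B) →
                          IsSubuniverseω (Pendant.mem P b)
  fibre-isSubuniverseω B P b = record
    { resp      = presp
    ; closed-f  = λ rs → subst (λ x → mem x _) (VAlgebra.f-idem B b) ∘ pclo-f (λ _ → b) rs
    ; closed-g₁ = λ rs → subst (λ x → mem x _) (VAlgebra.g₁-idem B b) ∘ pclo-g₁ (λ _ → b) rs
    ; closed-g₂ = λ rs → subst (λ x → mem x _) (VAlgebra.g₂-idem B b) ∘ pclo-g₂ (λ _ → b) rs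
    }
    where open Pendant P

module Inflation {m : ℕ} (N : ℕ) .{{_ : NonZero N}} (ρ : Seq m) where
  open Blocks N
  open IsSubuniverseω

  inflate : Seq m → Seq m
  inflate r k = r (k / N) [𝟏≔ ρ (k % N) ]

  inflate-isSubuniverseω : ∀ {S} → IsSubuniverseω S → IsSubuniverseω (S ∘ inflate)
  inflate-isSubuniverseω S-sub = record
    { resp      = λ s r≈r' → resp S-sub s (λ k → [𝟏≔]-cong _ (r≈r' (k / N)))
    ; closed-f  = λ rs → closed-f S-sub (inflate ∘ rs)
    ; closed-g₁ = λ rs → closed-g₁ S-sub (inflate ∘ rs)
    ; closed-g₂ = λ rs → closed-g₂ S-sub (inflate ∘ rs)
    }

  swapBlocks : ℕ → ℕ ↔ ℕ
  swapBlocks l = relocate↔ (transpose ℕ._≟_ 0 l) (transpose-involutive ℕ._≟_ 0 l)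

  inflate-unitSeq : VanishesFrom N ρ → ∀ l → _≈ω_ m (inflate (unitSeq m l)) (ρ ∘ Inverse.to (swapBlocks l))
  inflate-unitSeq ρ-vanishes l k = by-cases (k / N ℕ.≟ l)
    where
    open ≡-Reasoning
    t : ℕ → ℕ
    t = transpose ℕ._≟_ 0 l

    by-cases : Dec (k / N ≡ l) → _≈_ m (unitSeq m l (k / N) [𝟏≔ ρ (k % N) ]) (ρ (relocate t k))
    by-cases (yes q≡l) = ≈-reflexive (begin
      unitSeq m l (k / N) [𝟏≔ ρ (k % N) ] ≡⟨ cong (λ q → unitSeq m l q [𝟏≔ ρ (k % N) ]) q≡l ⟩
      unitSeq m l l [𝟏≔ ρ (k % N) ]       ≡⟨ cong (_[𝟏≔ ρ (k % N) ]) (unitSeq-self l) ⟩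
      ρ (k % N)                           ≡⟨ cong ρ (relocate-first t k t[q]≡0) ⟨
      ρ (relocate t k)                    ∎)
      where
      t[q]≡0 : t (k / N) ≡ 0
      t[q]≡0 = trans (cong t q≡l) (transpose-ʳ ℕ._≟_ 0 l)
    by-cases (no q≢l) = trans≈ (≈-reflexive (cong (_[𝟏≔ ρ (k % N) ]) (unitSeq-≢ q≢l)))
                               (sym≈ (ρ-vanishes _ (relocate-later t k t[q]≢0)))
      where
      t[q]≢0 : t (k / N) ≢ 0
      t[q]≢0 t[q]≡0 = q≢l (begin
        k / N         ≡⟨ transpose-involutive ℕ._≟_ 0 l (k / N) ⟨
        t (t (k / N)) ≡⟨ cong t t[q]≡0 ⟩
        t 0           ≡⟨ transpose-ˡ ℕ._≟_ 0 l ⟩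
        l             ∎)

  Rω⇒inflate : VanishesFrom N ρ → ∀ {S} → IsSubuniverseω S → (∀ π → S (ρ ∘ Inverse.to π)) →
               ∀ {r} → Rω m r → S (inflate r)
  Rω⇒inflate ρ-vanishes S-sub Sρ = Rω-least (inflate-isSubuniverseω S-sub)
    (λ l → resp S-sub (Sρ (swapBlocks l)) (≈ω-sym (inflate-unitSeq ρ-vanishes l)))

  module _ (B : VAlgebra m) (P : Pendant m B) where
    open Pendant P

    inflate⁻¹ : Pendant m B
    inflate⁻¹ = record
      { mem     = λ x r → (π : ℕ ↔ ℕ) → mem x (inflate (r ∘ Inverse.to π))
      ; presp   = λ x∈ r≈r' π → presp (x∈ π) (λ k → [𝟏≔]-cong _ (r≈r' (Inverse.to π (k / N))))
      ; pclo-f  = λ bs rs x∈ π → pclo-f bs (λ j → inflate (rs j ∘ Inverse.to π)) (λ j → x∈ j π)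
      ; pclo-g₁ = λ bs rs x∈ π → pclo-g₁ bs (λ j → inflate (rs j ∘ Inverse.to π)) (λ j → x∈ j π)
      ; pclo-g₂ = λ bs rs x∈ π → pclo-g₂ bs (λ j → inflate (rs j ∘ Inverse.to π)) (λ j → x∈ j π)
      ; pperm   = λ π' x∈ π → x∈ (π' ↔-∘ π)
      }

    Rω⊆inflate⁻¹ : VanishesFrom N ρ → ∀ {b} → mem b ρ → ∀ r → Rω m r → Pendant.mem inflate⁻¹ b r
    Rω⊆inflate⁻¹ ρ-vanishes {b} b∈Pρ r r∈R π =
      Rω⇒inflate ρ-vanishes (fibre-isSubuniverseω B P b) (λ π' → pperm π' b∈Pρ) (Rω-∘↔ r∈R π)

mainTheorem6 : (m : ℕ) → 1 ≤ m → (B : VAlgebra m) → (C : Subuniverse m B) →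
    (b : VAlgebra.Carrier B) → (P : Pendant m B) →
    (∀ c → Subuniverse.mem C c → _∣₀ m B P c) →
    _∣₁ m B P b →
    ∀ x → gen∣₁ m B C b x → _∣₁ m B P x
mainTheorem6 m _ B C b P C⊆P∣₀ (ρ , ρ∈R , b∈Pρ) x (r , r∈R , x∈C[b]) =
  inflate r ,
  Rω⇒inflate ρ-vanishes Rω-isSubuniverseω (Rω-∘↔ ρ∈R) r∈R ,
  x∈C[b] (inflate⁻¹ B P) (λ c c∈C _ → C⊆P∣₀ c c∈C) (Rω⊆inflate⁻¹ B P ρ-vanishes b∈Pρ) (↔-id ℕ)
  where
  M : ℕ
  M = proj₁ (Rω-finitelySupported ρ∈R)
  open Inflation (suc M) ρ
  ρ-vanishes : VanishesFrom (suc M) ρ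
  ρ-vanishes = VanishesFrom-mono (n≤1+n M) (proj₂ (Rω-finitelySupported ρ∈R))
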